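{- Let $G$ be a finite simple bipartite graph with stable sets (bipartition classes) $C_1$ and $C_2$, with $c_i=|C_i|$ for $i=1,2$ and $c_1\le c_2$. Let $k\ge 2$ be an integer. Then the $k$-supertoken graph $\mathcal F_k(G)$ is bipartite and its independence number satisfies $$\alpha(\mathcal F_k(G))\ge \sum_{i=0}^{\lfloor k/2\rfloor}\binom{c_1+2i-1}{2i}\binom{c_2+k-2i-1}{k-2i}.$$
   Context: For a finite simple graph $G$ and integer $k\ge 1$, the $k$-supertoken graph $\mathcal F_k(G)$ has as vertices all multisets of size $k$ of elements of $V(G)$. Two such multisets $A,B$ are adjacent iff $A=S\uplus\{u\}$ and $B=S\uplus\{v\}$ for some multiset $S$ of size $k-1$ and some edge $uv\in E(G)$. $\alpha$ denotes the independence number. -}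

module Defs where

open import Data.Nat using (ℕ; zero; suc; _+_; _*_; _∸_; _≤_; _/_)
open import Data.Nat.Combinatorics using (_C_)
open import Data.Bool using (Bool)
open import Data.Fin using (Fin)
open import Data.Fin.Subset using (Subset; _∈_; ∁; ∣_∣)
open import Data.Vec using (Vec; updateAt)
import Data.Vec as Vec
open import Data.List using (List; upTo; length)
import Data.List as List
import Data.Nat.ListAction as LA
open import Data.List.Relation.Unary.Unique.Propositional using (Unique)
import Data.List.Membership.Propositional as LMem
open import Data.Product using (Σ; ∃; ∃-syntax; _×_; proj₁)
open import Relation.Binary.PropositionalEquality using (_≡_; _≢_)
open import Relation.Nullary using (¬_)

record SimpleGraph (n : ℕ) : Set₁ where
  field
    Adj       : Fin n → Fin n → Set
    symm      : ∀ {u v} → Adj u v → Adj v u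
    irrefl    : ∀ {u} → ¬ Adj u u

open SimpleGraph public

Stable : ∀ {n} → SimpleGraph n → Subset n → Set
Stable G C = ∀ u v → u ∈ C → v ∈ C → ¬ Adj G u v

Multiset : ℕ → ℕ → Set
Multiset n k = Σ (Vec ℕ n) (λ m → Vec.sum m ≡ k)

addElem : ∀ {n} → Vec ℕ n → Fin n → Vec ℕ n
addElem S u = updateAt S u suc

SupertokenAdj : ∀ {n} (G : SimpleGraph n) (k : ℕ) → Multiset n k → Multiset n k → Set
SupertokenAdj {n} G k A B =
  Σ (Multiset n (k ∸ 1)) λ S → ∃[ u ] ∃[ v ]
    (Adj G u v × proj₁ A ≡ addElem (proj₁ S) u × proj₁ B ≡ addElem (proj₁ S) v)

SupertokenBipartite : ∀ {n} (G : SimpleGraph n) (k : ℕ) → Set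
SupertokenBipartite {n} G k =
  Σ (Multiset n k → Bool) λ f →
    ∀ (A B : Multiset n k) → SupertokenAdj G k A B → f A ≢ f B

IndependenceAtLeast : ∀ {n} (G : SimpleGraph n) (k : ℕ) → ℕ → Set
IndependenceAtLeast {n} G k N =
  Σ (List (Multiset n k)) λ I →
    Unique (List.map proj₁ I)
    × (∀ A B → A LMem.∈ I → B LMem.∈ I → ¬ SupertokenAdj G k A B)
    × N ≤ length I

-- Σ_{i=0}^{⌊k/2⌋} C(c1+2i-1, 2i) · C(c2+k-2i-1, k-2i)
-- (with the convention C(-1,0) = 1, realised via truncated subtraction).
boundSum : ℕ → ℕ → ℕ → ℕ
boundSum c₁ c₂ k =
  LA.sum (List.map
    (λ i → (((c₁ + 2 * i) ∸ 1) C (2 * i)) * (((c₂ + (k ∸ 2 * i)) ∸ 1) C (k ∸ 2 * i)))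
    (upTo (suc (k / 2))))

-- Colour a multiset by the parity of its number of tokens in C₁. A supertoken edge moves one
-- token along an edge of G, i.e. between C₁ and C₂, so it changes that number by exactly one and
-- the colouring is proper. Hence the multisets with an even number 2i of tokens in C₁ form an
-- independent set; for each i there are multichoose(c₁, 2i) · multichoose(c₂, k − 2i) of them,
-- and multichoose(m, a) = C(m + a − 1, a) is the i-th term of the bound.
module Submission where

open import Defs
open import Data.Nat using (ℕ; zero; suc; _+_; _*_; _∸_; _≤_; _/_; s≤s⁻¹)
open import Data.Nat.Properties
open import Algebra.Properties.CommutativeSemigroup +-commutativeSemigroup using (x∙yz≈y∙xz)
open import Data.Nat.Combinatorics using (_C_; nCk+nC[k+1]≡[n+1]C[k+1]; k>n⇒nCk≡0)
open import Data.Nat.DivMod using (m/n*n≤m)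
import Data.Nat.ListAction as LA
open import Data.Bool using (Bool; true; false; not)
open import Data.Bool.Properties using (not-¬; not-involutive)
open import Data.Fin.Subset using (Subset; ∁; ∣_∣; _∈_)
open import Data.Fin.Subset.Properties using (_∈?_; x∉p⇒x∈∁p)
open import Data.Vec using (Vec; []; _∷_; here; there)
import Data.Vec as Vec
import Data.Vec.Properties as Vec
open import Data.List using (List; []; _∷_; _++_; [_]; length; map; concatMap; upTo)
import Data.List.Properties as List
open import Data.List.Relation.Unary.All as All using (All)
import Data.List.Relation.Unary.All.Properties as All
import Data.List.Relation.Unary.AllPairs as AllPairs
import Data.List.Relation.Unary.AllPairs.Properties as AllPairs
open import Data.List.Relation.Unary.Unique.Propositional using (Unique)
import Data.List.Relation.Unary.Unique.Propositional.Properties as Unique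
open import Data.List.Membership.Propositional using (find) renaming (_∈_ to _∈ₗ_)
open import Data.List.Membership.Propositional.Properties
  using (∈-++⁻; ∈-map⁺; ∈-map⁻; ∈-concatMap⁻; ∈-upTo⁻)
open import Data.Product using (∃-syntax; _×_; _,_; proj₁; map₁; map₂)
open import Data.Sum using (_⊎_; inj₁; inj₂)
open import Data.Empty using (⊥-elim)
open import Function using (_∘_)
open import Relation.Binary.PropositionalEquality
  using (_≡_; _≢_; refl; sym; trans; cong; cong₂; subst; module ≡-Reasoning)
open import Relation.Nullary using (¬_; yes; no)

odd : ℕ → Bool
odd zero    = false
odd (suc n) = not (odd n)

odd-suc≢ : ∀ m → odd (suc m) ≢ odd m
odd-suc≢ m eq = not-¬ refl (sym eq)

odd-double : ∀ i → odd (2 * i) ≡ false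
odd-double zero    = refl
odd-double (suc i) rewrite +-suc i (i + 0) = trans (not-involutive _) (odd-double i)

tokensIn : ∀ {n} → Subset n → Vec ℕ n → ℕ
tokensIn []          []      = 0
tokensIn (true  ∷ P) (x ∷ v) = x + tokensIn P v
tokensIn (false ∷ P) (x ∷ v) = tokensIn P v

tokensIn-+-∁ : ∀ {n} (P : Subset n) v → tokensIn P v + tokensIn (∁ P) v ≡ Vec.sum v
tokensIn-+-∁ []          []      = refl
tokensIn-+-∁ (true  ∷ P) (x ∷ v) = trans (+-assoc x _ _) (cong (x +_) (tokensIn-+-∁ P v))
tokensIn-+-∁ (false ∷ P) (x ∷ v) =
  trans (x∙yz≈y∙xz (tokensIn P v) x _) (cong (x +_) (tokensIn-+-∁ P v))

tokensIn-addElem-∈ : ∀ {n} (P : Subset n) S {u} → u ∈ P →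
  tokensIn P (addElem S u) ≡ suc (tokensIn P S)
tokensIn-addElem-∈ (true  ∷ P) (x ∷ S) here       = refl
tokensIn-addElem-∈ (true  ∷ P) (x ∷ S) (there u∈P) =
  trans (cong (x +_) (tokensIn-addElem-∈ P S u∈P)) (+-suc x _)
tokensIn-addElem-∈ (false ∷ P) (x ∷ S) (there u∈P) = tokensIn-addElem-∈ P S u∈P

tokensIn-addElem-∁ : ∀ {n} (P : Subset n) S {u} → u ∈ ∁ P →
  tokensIn P (addElem S u) ≡ tokensIn P S
tokensIn-addElem-∁ (false ∷ P) (x ∷ S) here        = refl
tokensIn-addElem-∁ (true  ∷ P) (x ∷ S) (there u∈∁P) = cong (x +_) (tokensIn-addElem-∁ P S u∈∁P)
tokensIn-addElem-∁ (false ∷ P) (x ∷ S) (there u∈∁P) = tokensIn-addElem-∁ P S u∈∁P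

module _ {n} (G : SimpleGraph n) {P : Subset n}
         (P-stable : Stable G P) (∁P-stable : Stable G (∁ P)) where

  adjacent⇒tokensIn-suc : ∀ {k} (A B : Multiset n k) → SupertokenAdj G k A B →
    tokensIn P (proj₁ A) ≡ suc (tokensIn P (proj₁ B))
      ⊎ tokensIn P (proj₁ B) ≡ suc (tokensIn P (proj₁ A))
  adjacent⇒tokensIn-suc (_ , _) (_ , _) ((S , _) , u , v , uv , refl , refl) with u ∈? P | v ∈? P
  ... | yes u∈P | yes v∈P = ⊥-elim (P-stable u v u∈P v∈P uv)
  ... | no  u∉P | no  v∉P = ⊥-elim (∁P-stable u v (x∉p⇒x∈∁p u∉P) (x∉p⇒x∈∁p v∉P) uv)
  ... | yes u∈P | no  v∉P = inj₁ (trans (tokensIn-addElem-∈ P S u∈P)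
    (cong suc (sym (tokensIn-addElem-∁ P S (x∉p⇒x∈∁p v∉P)))))
  ... | no  u∉P | yes v∈P = inj₂ (trans (tokensIn-addElem-∈ P S v∈P)
    (cong suc (sym (tokensIn-addElem-∁ P S (x∉p⇒x∈∁p u∉P)))))

  parityColouring : ∀ {k} → Multiset n k → Bool
  parityColouring A = odd (tokensIn P (proj₁ A))

  adjacent⇒parityColouring-≢ : ∀ {k} (A B : Multiset n k) → SupertokenAdj G k A B →
    parityColouring A ≢ parityColouring B
  adjacent⇒parityColouring-≢ A B adj with adjacent⇒tokensIn-suc A B adj
  ... | inj₁ eq rewrite eq = odd-suc≢ (tokensIn P (proj₁ B))
  ... | inj₂ eq rewrite eq = odd-suc≢ (tokensIn P (proj₁ A)) ∘ sym

  supertokenBipartite : ∀ k → SupertokenBipartite G k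
  supertokenBipartite k = parityColouring , adjacent⇒parityColouring-≢

multichoose : ℕ → ℕ → ℕ
multichoose zero    zero    = 1
multichoose zero    (suc a) = 0
multichoose (suc m) zero    = 1
multichoose (suc m) (suc a) = multichoose (suc m) a + multichoose m (suc a)

multichoose-zero : ∀ m → multichoose m 0 ≡ 1
multichoose-zero zero    = refl
multichoose-zero (suc m) = refl

multichoose≡C : ∀ m a → multichoose m a ≡ (m + a ∸ 1) C a
multichoose≡C zero    zero    = refl
multichoose≡C zero    (suc a) = sym (k>n⇒nCk≡0 (n<1+n a))
multichoose≡C (suc m) zero    = refl
multichoose≡C (suc m) (suc a) = begin
  multichoose (suc m) a + multichoose m (suc a)
    ≡⟨ cong₂ _+_ (multichoose≡C (suc m) a) (multichoose≡C m (suc a)) ⟩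
  (m + a) C a + (m + suc a ∸ 1) C suc a
    ≡⟨ cong (λ x → (m + a) C a + (x ∸ 1) C suc a) (+-suc m a) ⟩
  (m + a) C a + (m + a) C suc a
    ≡⟨ nCk+nC[k+1]≡[n+1]C[k+1] (m + a) a ⟩
  suc (m + a) C suc a
    ≡⟨ cong (_C suc a) (sym (+-suc m a)) ⟩
  (m + suc a) C suc a
    ∎
  where open ≡-Reasoning

incHead : ∀ {n} → Vec ℕ (suc n) → Vec ℕ (suc n)
incHead (x ∷ v) = suc x ∷ v

pascalSplit : ∀ {n} → List (Vec ℕ (suc n)) → List (Vec ℕ n) → List (Vec ℕ (suc n))
pascalSplit xs ys = map incHead xs ++ map (0 ∷_) ys

∈-pascalSplit⁻ : ∀ {n} xs ys {v : Vec ℕ (suc n)} → v ∈ₗ pascalSplit xs ys →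
  (∃[ w ] w ∈ₗ xs × v ≡ incHead w) ⊎ (∃[ w ] w ∈ₗ ys × v ≡ 0 ∷ w)
∈-pascalSplit⁻ xs ys v∈ with ∈-++⁻ (map incHead xs) v∈
... | inj₁ v∈xs = inj₁ (∈-map⁻ incHead v∈xs)
... | inj₂ v∈ys = inj₂ (∈-map⁻ (0 ∷_) v∈ys)

pascalSplit-unique : ∀ {n} {xs} {ys : List (Vec ℕ n)} →
  Unique xs → Unique ys → Unique (pascalSplit xs ys)
pascalSplit-unique {xs = xs} {ys} xs! ys! =
  Unique.++⁺ (Unique.map⁺ incHead-injective xs!) (Unique.map⁺ Vec.∷-injectiveʳ ys!) disjoint
  where
  incHead-injective : ∀ {x y} → incHead x ≡ incHead y → x ≡ y
  incHead-injective {_ ∷ _} {_ ∷ _} refl = refl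
  disjoint : ∀ {v} → ¬ (v ∈ₗ map incHead xs × v ∈ₗ map (0 ∷_) ys)
  disjoint (v∈xs , v∈ys) with ∈-map⁻ incHead v∈xs | ∈-map⁻ (0 ∷_) v∈ys
  ... | (_ ∷ _) , _ , refl | _ , _ , ()

length-pascalSplit : ∀ {n} xs (ys : List (Vec ℕ n)) →
  length (pascalSplit xs ys) ≡ length xs + length ys
length-pascalSplit xs ys = trans (List.length-++ (map incHead xs))
  (cong₂ _+_ (List.length-map incHead xs) (List.length-map (0 ∷_) ys))

-- Enumerated along the recursion of multichoose: the first coordinate is either positive and
-- gets decremented, or zero and gets dropped.
distributions : ∀ {n} → Subset n → ℕ → ℕ → List (Vec ℕ n)
distributions []          zero    zero    = [ [] ]
distributions []          _       _       = []
distributions (true  ∷ P) zero    b       = map (0 ∷_) (distributions P 0 b)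
distributions (true  ∷ P) (suc a) b       =
  pascalSplit (distributions (true ∷ P) a b) (distributions P (suc a) b)
distributions (false ∷ P) a       zero    = map (0 ∷_) (distributions P a 0)
distributions (false ∷ P) a       (suc b) =
  pascalSplit (distributions (false ∷ P) a b) (distributions P a (suc b))

distributions-tokensIn : ∀ {n} (P : Subset n) a b {v} → v ∈ₗ distributions P a b →
  tokensIn P v ≡ a × tokensIn (∁ P) v ≡ b
distributions-tokensIn []          zero    zero    {[]} _ = refl , refl
distributions-tokensIn (true  ∷ P) zero    b       v∈ with ∈-map⁻ (0 ∷_) v∈
... | _ , w∈ , refl = distributions-tokensIn P 0 b w∈
distributions-tokensIn (true  ∷ P) (suc a) b       v∈
  with ∈-pascalSplit⁻ (distributions (true ∷ P) a b) (distributions P (suc a) b) v∈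
... | inj₁ (_ ∷ _ , w∈ , refl) = map₁ (cong suc) (distributions-tokensIn (true ∷ P) a b w∈)
... | inj₂ (_ , w∈ , refl)     = distributions-tokensIn P (suc a) b w∈
distributions-tokensIn (false ∷ P) a       zero    v∈ with ∈-map⁻ (0 ∷_) v∈
... | _ , w∈ , refl = distributions-tokensIn P a 0 w∈
distributions-tokensIn (false ∷ P) a       (suc b) v∈
  with ∈-pascalSplit⁻ (distributions (false ∷ P) a b) (distributions P a (suc b)) v∈
... | inj₁ (_ ∷ _ , w∈ , refl) = map₂ (cong suc) (distributions-tokensIn (false ∷ P) a b w∈)
... | inj₂ (_ , w∈ , refl)     = distributions-tokensIn P a (suc b) w∈

distributions-unique : ∀ {n} (P : Subset n) a b → Unique (distributions P a b)
distributions-unique []          zero    zero    = All.[] AllPairs.∷ AllPairs.[]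
distributions-unique []          zero    (suc b) = AllPairs.[]
distributions-unique []          (suc a) b       = AllPairs.[]
distributions-unique (true  ∷ P) zero    b       = Unique.map⁺ Vec.∷-injectiveʳ (distributions-unique P 0 b)
distributions-unique (true  ∷ P) (suc a) b       =
  pascalSplit-unique (distributions-unique (true ∷ P) a b) (distributions-unique P (suc a) b)
distributions-unique (false ∷ P) a       zero    = Unique.map⁺ Vec.∷-injectiveʳ (distributions-unique P a 0)
distributions-unique (false ∷ P) a       (suc b) =
  pascalSplit-unique (distributions-unique (false ∷ P) a b) (distributions-unique P a (suc b))

length-distributions : ∀ {n} (P : Subset n) a b →
  length (distributions P a b) ≡ multichoose ∣ P ∣ a * (multichoose ∣ ∁ P ∣ b)
length-distributions []          zero    zero    = refl
length-distributions []          zero    (suc b) = refl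
length-distributions []          (suc a) b       = refl
length-distributions (true  ∷ P) zero    b       =
  trans (List.length-map (0 ∷_) (distributions P 0 b))
    (trans (length-distributions P 0 b) (cong (_* multichoose ∣ ∁ P ∣ b) (multichoose-zero ∣ P ∣)))
length-distributions (true  ∷ P) (suc a) b       =
  trans (length-pascalSplit (distributions (true ∷ P) a b) (distributions P (suc a) b))
    (trans (cong₂ _+_ (length-distributions (true ∷ P) a b) (length-distributions P (suc a) b))
      (sym (*-distribʳ-+ (multichoose ∣ ∁ P ∣ b) (multichoose (suc ∣ P ∣) a) _)))
length-distributions (false ∷ P) a       zero    =
  trans (List.length-map (0 ∷_) (distributions P a 0))
    (trans (length-distributions P a 0) (cong (multichoose ∣ P ∣ a *_) (multichoose-zero ∣ ∁ P ∣)))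
length-distributions (false ∷ P) a       (suc b) =
  trans (length-pascalSplit (distributions (false ∷ P) a b) (distributions P a (suc b)))
    (trans (cong₂ _+_ (length-distributions (false ∷ P) a b) (length-distributions P a (suc b)))
      (sym (*-distribˡ-+ (multichoose ∣ P ∣ a) _ _)))

module _ {A B : Set} (f : A → List B) where

  length-concatMap : ∀ xs → length (concatMap f xs) ≡ LA.sum (map (length ∘ f) xs)
  length-concatMap []       = refl
  length-concatMap (x ∷ xs) =
    trans (List.length-++ (f x)) (cong (length (f x) +_) (length-concatMap xs))

  concatMap-unique : ∀ {xs} → Unique xs → (∀ x → Unique (f x)) →
    (∀ {x y v} → v ∈ₗ f x → v ∈ₗ f y → x ≡ y) → Unique (concatMap f xs)
  concatMap-unique {xs} xs! f! f-separated = Unique.concat⁺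
    (All.map⁺ (All.universal f! xs))
    (AllPairs.map⁺ (AllPairs.map (λ x≢y {_} (v∈fx , v∈fy) → x≢y (f-separated v∈fx v∈fy)) xs!))

module _ {A : Set} {Q : A → Set} where

  map-proj₁-toList : ∀ {xs} (qs : All Q xs) → map proj₁ (All.toList qs) ≡ xs
  map-proj₁-toList All.[]       = refl
  map-proj₁-toList (_ All.∷ qs) = cong (_ ∷_) (map-proj₁-toList qs)

  ∈-toList⁻ : ∀ {xs} (qs : All Q xs) {x} → x ∈ₗ All.toList qs → proj₁ x ∈ₗ xs
  ∈-toList⁻ qs x∈ = subst (_ ∈ₗ_) (map-proj₁-toList qs) (∈-map⁺ proj₁ x∈)

  length-toList : ∀ {xs} (qs : All Q xs) → length (All.toList qs) ≡ length xs
  length-toList qs =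
    trans (sym (List.length-map proj₁ (All.toList qs))) (cong length (map-proj₁-toList qs))

module _ {n} (P : Subset n) (k : ℕ) where

  private
    evenSlice : ℕ → List (Vec ℕ n)
    evenSlice i = distributions P (2 * i) (k ∸ 2 * i)

    halves : List ℕ
    halves = upTo (suc (k / 2))

  evenDistributions : List (Vec ℕ n)
  evenDistributions = concatMap evenSlice halves

  ∈-evenDistributions⁻ : ∀ {v} → v ∈ₗ evenDistributions → ∃[ i ] 2 * i ≤ k × v ∈ₗ evenSlice i
  ∈-evenDistributions⁻ v∈ with find (∈-concatMap⁻ evenSlice {xs = halves} v∈)
  ... | i , i∈ , v∈slice = i , 2i≤k , v∈slice
    where
    2i≤k : 2 * i ≤ k
    2i≤k = ≤-trans (*-monoʳ-≤ 2 (s≤s⁻¹ (∈-upTo⁻ i∈)))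
             (≤-trans (≤-reflexive (*-comm 2 (k / 2))) (m/n*n≤m k 2))

  evenDistributions-sum : ∀ {v} → v ∈ₗ evenDistributions → Vec.sum v ≡ k
  evenDistributions-sum {v} v∈ with ∈-evenDistributions⁻ v∈
  ... | i , 2i≤k , v∈slice with distributions-tokensIn P (2 * i) (k ∸ 2 * i) v∈slice
  ... | inP , in∁P = begin
    Vec.sum v                               ≡⟨ sym (tokensIn-+-∁ P v) ⟩
    tokensIn P v + tokensIn (∁ P) v         ≡⟨ cong₂ _+_ inP in∁P ⟩
    2 * i + (k ∸ 2 * i)                     ≡⟨ m+[n∸m]≡n 2i≤k ⟩
    k                                       ∎
    where open ≡-Reasoning

  evenDistributions-even : ∀ {v} → v ∈ₗ evenDistributions → odd (tokensIn P v) ≡ false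
  evenDistributions-even v∈ with ∈-evenDistributions⁻ v∈
  ... | i , _ , v∈slice =
    trans (cong odd (proj₁ (distributions-tokensIn P _ _ v∈slice))) (odd-double i)

  evenDistributions-unique : Unique evenDistributions
  evenDistributions-unique = concatMap-unique evenSlice {halves} (Unique.upTo⁺ _)
    (λ i → distributions-unique P (2 * i) (k ∸ 2 * i))
    (λ {i} {j} v∈i v∈j → *-cancelˡ-≡ i j 2
      (trans (sym (proj₁ (distributions-tokensIn P _ _ v∈i)))
             (proj₁ (distributions-tokensIn P _ _ v∈j))))

  length-evenDistributions : length evenDistributions ≡ boundSum ∣ P ∣ ∣ ∁ P ∣ k
  length-evenDistributions = trans (length-concatMap evenSlice halves)
    (cong LA.sum (List.map-cong length-evenSlice halves))
    where
    length-evenSlice : ∀ i → length (evenSlice i) ≡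
      ((∣ P ∣ + 2 * i ∸ 1) C (2 * i)) * ((∣ ∁ P ∣ + (k ∸ 2 * i) ∸ 1) C (k ∸ 2 * i))
    length-evenSlice i = trans (length-distributions P (2 * i) (k ∸ 2 * i))
      (cong₂ _*_ (multichoose≡C ∣ P ∣ (2 * i)) (multichoose≡C ∣ ∁ P ∣ (k ∸ 2 * i)))

  private
    sums : All (λ v → Vec.sum v ≡ k) evenDistributions
    sums = All.tabulate evenDistributions-sum

  evenMultisets : List (Multiset n k)
  evenMultisets = All.toList sums

  evenMultisets-unique : Unique (map proj₁ evenMultisets)
  evenMultisets-unique = subst Unique (sym (map-proj₁-toList sums)) evenDistributions-unique

  length-evenMultisets : length evenMultisets ≡ boundSum ∣ P ∣ ∣ ∁ P ∣ k
  length-evenMultisets = trans (length-toList sums) length-evenDistributions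

  evenMultisets-independent : (G : SimpleGraph n) → Stable G P → Stable G (∁ P) →
    ∀ A B → A ∈ₗ evenMultisets → B ∈ₗ evenMultisets → ¬ SupertokenAdj G k A B
  evenMultisets-independent G P-stable ∁P-stable A B A∈ B∈ adj =
    adjacent⇒parityColouring-≢ G P-stable ∁P-stable A B adj (trans (even A∈) (sym (even B∈)))
    where
    even : ∀ {A} → A ∈ₗ evenMultisets → parityColouring G P-stable ∁P-stable A ≡ false
    even A∈ = evenDistributions-even (∈-toList⁻ sums A∈)

mainTheorem2 : ∀ {n} (G : SimpleGraph n) (C₁ : Subset n) →
    Stable G C₁ → Stable G (∁ C₁) →
    ∣ C₁ ∣ ≤ ∣ ∁ C₁ ∣ →
    (k : ℕ) → 2 ≤ k →
    SupertokenBipartite G k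
      × IndependenceAtLeast G k (boundSum ∣ C₁ ∣ ∣ ∁ C₁ ∣ k)
mainTheorem2 G C₁ C₁-stable C₂-stable _ k _ =
  supertokenBipartite G C₁-stable C₂-stable k ,
  evenMultisets C₁ k ,
  evenMultisets-unique C₁ k ,
  evenMultisets-independent C₁ k G C₁-stable C₂-stable ,
  ≤-reflexive (sym (length-evenMultisets C₁ k))
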